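{- Let $G$ be a simple graph on vertex set $[v]$ whose connected components have $v_1,\dots,v_c$ vertices, and let $A_G=\{e_i-e_j: ij\text{ an edge of }G,\ i<j\}$. Then the multiplicity of $A_G$ with respect to the root lattice of $A_{v-1}$ is $m_R(A_G)=1$, and with respect to the weight lattice of $A_{v-1}$ it is $m_W(A_G)=\gcd(v_1,\dots,v_c)$.
   Context: The root lattice of $A_{v-1}$ is $\Lambda_R=\{a\in\mathbb{Z}^v:\sum a_i=0\}$ and its weight lattice is $\Lambda_W=\{a\in\mathbb{R}^v:\sum a_i=0,\ a\in\mathbb{Z}^v+\mathbb{R}(1,\dots,1)\}$. For a list $B$ of vectors in a lattice $\Lambda$, the multiplicity $m_\Lambda(B)$ is the index of $\mathbb{Z}B$ in $\operatorname{span}_{\mathbb{R}}(B)\cap\Lambda$. -}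

module Defs where

open import Data.Nat using (ℕ; zero; suc; _≤_)
open import Data.Nat.GCD using (gcd)
open import Data.Integer using (ℤ)
open import Data.Rational using (ℚ; 0ℚ; 1ℚ; _+_; _-_; _*_; _/_)
open import Data.Fin using (Fin; zero; suc; _<_; _≟_)
open import Data.List using (List; length; lookup; map; filter; foldr; allFin)
open import Data.List.Relation.Unary.All using (All)
open import Data.List.Relation.Unary.Unique.Propositional using (Unique)
open import Data.List.Membership.Propositional using (_∈_)
open import Data.Product using (Σ; _×_; _,_; ∃; ∃-syntax)
open import Data.Sum using (_⊎_)
open import Relation.Nullary using (does)
open import Relation.Binary.PropositionalEquality using (_≡_)
open import Relation.Binary.Construct.Closure.ReflexiveTransitive using (Star)
open import Function using (_⇔_)

Vecℚ : ℕ → Set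
Vecℚ v = Fin v → ℚ

Σℚ : ∀ {n} → (Fin n → ℚ) → ℚ
Σℚ {zero}  f = 0ℚ
Σℚ {suc n} f = f zero + Σℚ (λ i → f (suc i))

_≈_ : ∀ {v} → Vecℚ v → Vecℚ v → Set
x ≈ y = ∀ i → x i ≡ y i

_⊖_ : ∀ {v} → Vecℚ v → Vecℚ v → Vecℚ v
(x ⊖ y) i = x i - y i

IsInt : ℚ → Set
IsInt q = Σ ℤ λ z → q ≡ z / 1

ℤ→ℚ : ℤ → ℚ
ℤ→ℚ z = z / 1

lincomb : ∀ {v} (B : List (Vecℚ v)) → (Fin (length B) → ℚ) → Vecℚ v
lincomb B c i = Σℚ (λ k → c k * lookup B k i)

InZSpan : ∀ {v} → List (Vecℚ v) → Vecℚ v → Set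
InZSpan B x = Σ (Fin (length B) → ℤ) λ c → x ≈ lincomb B (λ k → ℤ→ℚ (c k))

InSpan : ∀ {v} → List (Vecℚ v) → Vecℚ v → Set
InSpan B x = Σ (Fin (length B) → ℚ) λ c → x ≈ lincomb B c

RootLattice : ∀ {v} → Vecℚ v → Set
RootLattice a = (∀ i → IsInt (a i)) × Σℚ a ≡ 0ℚ

-- weight lattice of A_{v-1}: sum 0 and a ∈ ℤ^v + ℚ(1,…,1)
WeightLattice : ∀ {v} → Vecℚ v → Set
WeightLattice a = Σℚ a ≡ 0ℚ × Σ ℚ λ t → ∀ i → IsInt (a i - t)

-- "ℤB has index m in span(B) ∩ Λ": there are m coset representatives
-- r_0,…,r_{m-1} in span(B) ∩ Λ such that every x in span(B) ∩ Λ lies in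
-- r_k + ℤB for exactly one k.
HasIndex : ∀ {v} → (Vecℚ v → Set) → List (Vecℚ v) → ℕ → Set
HasIndex {v} Λ B m =
  Σ (Fin m → Vecℚ v) λ r →
    (∀ k → InSpan B (r k) × Λ (r k)) ×
    (∀ x → InSpan B x → Λ x →
       Σ (Fin m) λ k → InZSpan B (x ⊖ r k) ×
         (∀ k′ → InZSpan B (x ⊖ r k′) → k′ ≡ k))

Multiplicity≡ : ∀ {v} → (Vecℚ v → Set) → List (Vecℚ v) → ℕ → Set
Multiplicity≡ = HasIndex

record SimpleGraph (v : ℕ) : Set where
  field
    edges    : List (Fin v × Fin v)
    ordered  : All (λ e → Data.Product.proj₁ e < Data.Product.proj₂ e) edges
    noRepeat : Unique edges

open SimpleGraph public

Adj : ∀ {v} → SimpleGraph v → Fin v → Fin v → Set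
Adj G i j = ((i , j) ∈ edges G) ⊎ ((j , i) ∈ edges G)

Connected : ∀ {v} → SimpleGraph v → Fin v → Fin v → Set
Connected G = Star (Adj G)

basis : ∀ {v} → Fin v → Vecℚ v
basis i k = if does (k ≟ i) then 1ℚ else 0ℚ
  where open import Data.Bool using (if_then_else_)

A[_] : ∀ {v} → SimpleGraph v → List (Vecℚ v)
A[ G ] = map (λ e → basis (Data.Product.proj₁ e) ⊖ basis (Data.Product.proj₂ e)) (edges G)

record ComponentLabelling {v} (G : SimpleGraph v) (c : ℕ) : Set where
  field
    label    : Fin v → Fin c
    onto     : ∀ k → ∃[ i ] label i ≡ k
    sameComp : ∀ i j → (label i ≡ label j) ⇔ Connected G i j

open ComponentLabelling public

compSize : ∀ {v} {G : SimpleGraph v} {c} → ComponentLabelling G c → Fin c → ℕ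
compSize {v} L k = length (filter (λ i → label L i ≟ k) (allFin v))

gcdList : List ℕ → ℕ
gcdList = foldr gcd 0

compGcd : ∀ {v} {G : SimpleGraph v} {c} → ComponentLabelling G c → ℕ
compGcd {c = c} L = gcdList (map (compSize L) (allFin c))

-- Summing a vector over a connected component kills every generator e_i − e_j of A_G, so
-- the span of A_G lies in the space of vectors whose component sums all vanish.
-- Conversely such an x equals Σ_i x_i (e_i − e_{ρ i}), where ρ i is a fixed root of the
-- component of i, and e_i − e_{ρ i} telescopes along a path into an integer combination
-- of edge vectors.  Hence span(A_G) ∩ ℤ^v = ℤA_G and m_R(A_G) = 1.
--
-- A point of span(A_G) ∩ Λ_W is z + t(1,…,1) with z integral; its component sums give
-- t v_m ∈ ℤ for every m, hence t g ∈ ℤ for g = gcd(v_1,…,v_c) by Bézout.  The vectors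
-- r_k = (k/g)(1,…,1) − Σ_m (k v_m/g) e_{ρ m}, 0 ≤ k < g, have vanishing component sums
-- and lie in Λ_W, and x − r_k ∈ ℤA_G exactly when t − k/g ∈ ℤ, which holds for exactly
-- one k.  So the r_k are coset representatives and m_W(A_G) = g.
module Submission where

open import Defs
open import Data.Bool using (if_then_else_)
open import Data.Empty using (⊥-elim)
open import Data.Fin using (Fin; zero; suc; toℕ; fromℕ<) renaming (_≟_ to _≟ᶠ_)
import Data.Fin.Properties as Finₚ
open import Data.Integer as ℤ using (ℤ; +_; -[1+_])
import Data.Integer.Properties as ℤₚ
open import Data.Integer.DivMod using (_%ℕ_; _/ℕ_; n%ℕd<d; a≡a%ℕn+[a/ℕn]*n)
open import Data.Integer.Tactic.RingSolver using (solve-∀)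
open import Data.List using (List; []; _∷_; length; lookup; map; filter; allFin; tabulate)
open import Data.List.Membership.Propositional using (_∈_)
open import Data.List.Membership.Propositional.Properties using (∈-allFin; ∈-lookup; ∈-map⁺; ∈-map⁻)
open import Data.List.Relation.Unary.Any as Any using (here; there)
open import Data.List.Relation.Unary.Any.Properties using (lookup-index)
open import Data.Nat as ℕ using (ℕ; zero; suc; _≤_; s≤s; z≤n)
import Data.Nat.Properties as ℕₚ
open import Data.Nat.Coprimality using (1-coprimeTo) renaming (sym to coprime-sym)
open import Data.Nat.Divisibility using (_∣_; ∣-trans; 0∣⇒≡0)
open import Data.Nat.GCD using (gcd; gcd[m,n]∣m; gcd[m,n]∣n; gcd-GCD; module Bézout)
open import Data.Product using (Σ; _×_; _,_; proj₁; proj₂)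
open import Data.Rational using (ℚ; mkℚ; 0ℚ; 1ℚ; _+_; _*_; _-_; -_; 1/_; ↥_)
import Data.Rational.Properties as ℚₚ
open import Data.Rational.Solver using (module +-*-Solver)
open +-*-Solver using (solve; _:+_; _:*_; _:-_; :-_; _:=_; con)
open import Data.Rational.Unnormalised using (*≡*)
import Data.Rational.Unnormalised.Properties as ℚᵘₚ
open import Data.Sum using (inj₁; inj₂)
open import Function using (Equivalence; _∘_)
open import Relation.Binary.Construct.Closure.ReflexiveTransitive using (ε; _◅_)
open import Relation.Binary.PropositionalEquality
open import Relation.Nullary using (Dec; yes; no; does; ¬_)

-- ℤ→ℚ z = z / 1 goes through normalisation; integer z is the same number built directly in
-- normal form, which lets the homomorphism laws below be transferred from ℚᵘ.
integer : ℤ → ℚ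
integer z = mkℚ z 0 (coprime-sym (1-coprimeTo ℤ.∣ z ∣))

ℤ→ℚ≡integer : ∀ z → ℤ→ℚ z ≡ integer z
ℤ→ℚ≡integer z = ℚₚ.↥p/↧p≡p (integer z)

ℤ→ℚ-homo-+ : ∀ a b → ℤ→ℚ (a ℤ.+ b) ≡ ℤ→ℚ a + ℤ→ℚ b
ℤ→ℚ-homo-+ a b = begin
  ℤ→ℚ (a ℤ.+ b)                ≡⟨ ℤ→ℚ≡integer (a ℤ.+ b) ⟩
  integer (a ℤ.+ b)            ≡⟨ ℚₚ.toℚᵘ-injective (ℚᵘₚ.≃-sym (ℚᵘₚ.≃-trans
                                    (ℚₚ.toℚᵘ-homo-+ (integer a) (integer b))
                                    (*≡* (cong (ℤ._* + 1) (cong₂ ℤ._+_ (ℤₚ.*-identityʳ a) (ℤₚ.*-identityʳ b)))))) ⟩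
  integer a + integer b        ≡⟨ sym (cong₂ _+_ (ℤ→ℚ≡integer a) (ℤ→ℚ≡integer b)) ⟩
  ℤ→ℚ a + ℤ→ℚ b                ∎
  where open ≡-Reasoning

ℤ→ℚ-homo-* : ∀ a b → ℤ→ℚ (a ℤ.* b) ≡ ℤ→ℚ a * ℤ→ℚ b
ℤ→ℚ-homo-* a b = begin
  ℤ→ℚ (a ℤ.* b)                ≡⟨ ℤ→ℚ≡integer (a ℤ.* b) ⟩
  integer (a ℤ.* b)            ≡⟨ ℚₚ.toℚᵘ-injective (ℚᵘₚ.≃-sym (ℚᵘₚ.≃-trans
                                    (ℚₚ.toℚᵘ-homo-* (integer a) (integer b)) (*≡* refl))) ⟩
  integer a * integer b        ≡⟨ sym (cong₂ _*_ (ℤ→ℚ≡integer a) (ℤ→ℚ≡integer b)) ⟩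
  ℤ→ℚ a * ℤ→ℚ b                ∎
  where open ≡-Reasoning

ℤ→ℚ-homo‿- : ∀ a → ℤ→ℚ (ℤ.- a) ≡ - ℤ→ℚ a
ℤ→ℚ-homo‿- a = begin
  ℤ→ℚ (ℤ.- a)                  ≡⟨ ℤ→ℚ≡integer (ℤ.- a) ⟩
  integer (ℤ.- a)              ≡⟨ ℚₚ.toℚᵘ-injective (ℚᵘₚ.≃-sym (ℚᵘₚ.≃-trans
                                    (ℚₚ.toℚᵘ-homo‿- (integer a)) (*≡* refl))) ⟩
  - integer a                  ≡⟨ sym (cong -_ (ℤ→ℚ≡integer a)) ⟩
  - ℤ→ℚ a                      ∎
  where open ≡-Reasoning

ℤ→ℚ-injective : ∀ {a b} → ℤ→ℚ a ≡ ℤ→ℚ b → a ≡ b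
ℤ→ℚ-injective {a} {b} eq = cong ↥_ (trans (sym (ℤ→ℚ≡integer a)) (trans eq (ℤ→ℚ≡integer b)))

ℕ→ℚ : ℕ → ℚ
ℕ→ℚ n = ℤ→ℚ (+ n)

ℕ→ℚ-homo-+ : ∀ m n → ℕ→ℚ (m ℕ.+ n) ≡ ℕ→ℚ m + ℕ→ℚ n
ℕ→ℚ-homo-+ m n = ℤ→ℚ-homo-+ (+ m) (+ n)

ℕ→ℚ-homo-* : ∀ m n → ℕ→ℚ (m ℕ.* n) ≡ ℕ→ℚ m * ℕ→ℚ n
ℕ→ℚ-homo-* m n = trans (cong ℤ→ℚ (ℤₚ.pos-* m n)) (ℤ→ℚ-homo-* (+ m) (+ n))

IsInt-resp : ∀ {p q} → p ≡ q → IsInt q → IsInt p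
IsInt-resp refl q∈ℤ = q∈ℤ

IsInt-ℤ→ℚ : ∀ z → IsInt (ℤ→ℚ z)
IsInt-ℤ→ℚ z = z , refl

IsInt-0 : IsInt 0ℚ
IsInt-0 = IsInt-ℤ→ℚ (+ 0)

IsInt-1 : IsInt 1ℚ
IsInt-1 = IsInt-ℤ→ℚ (+ 1)

IsInt-+ : ∀ {p q} → IsInt p → IsInt q → IsInt (p + q)
IsInt-+ (a , refl) (b , refl) = a ℤ.+ b , sym (ℤ→ℚ-homo-+ a b)

IsInt-* : ∀ {p q} → IsInt p → IsInt q → IsInt (p * q)
IsInt-* (a , refl) (b , refl) = a ℤ.* b , sym (ℤ→ℚ-homo-* a b)

IsInt-neg : ∀ {p} → IsInt p → IsInt (- p)
IsInt-neg (a , refl) = ℤ.- a , sym (ℤ→ℚ-homo‿- a)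

IsInt-minus : ∀ {p q} → IsInt p → IsInt q → IsInt (p - q)
IsInt-minus p∈ℤ q∈ℤ = IsInt-+ p∈ℤ (IsInt-neg q∈ℤ)

indicator : ∀ {a} {P : Set a} → Dec P → ℚ
indicator d = if does d then 1ℚ else 0ℚ

indicator-yes : ∀ {a} {P : Set a} (d : Dec P) → P → indicator d ≡ 1ℚ
indicator-yes (yes _) _ = refl
indicator-yes (no ¬p) p = ⊥-elim (¬p p)

indicator-no : ∀ {a} {P : Set a} (d : Dec P) → ¬ P → indicator d ≡ 0ℚ
indicator-no (yes p) ¬p = ⊥-elim (¬p p)
indicator-no (no _) _ = refl

IsInt-indicator : ∀ {a} {P : Set a} (d : Dec P) → IsInt (indicator d)
IsInt-indicator (yes _) = IsInt-1
IsInt-indicator (no _) = IsInt-0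

Σℚ-cong : ∀ {n} {f g : Fin n → ℚ} → (∀ i → f i ≡ g i) → Σℚ f ≡ Σℚ g
Σℚ-cong {zero} f≗g = refl
Σℚ-cong {suc n} f≗g = cong₂ _+_ (f≗g zero) (Σℚ-cong (λ i → f≗g (suc i)))

Σℚ-0 : ∀ n → Σℚ {n} (λ _ → 0ℚ) ≡ 0ℚ
Σℚ-0 zero = refl
Σℚ-0 (suc n) = cong (_+_ 0ℚ) (Σℚ-0 n)

Σℚ-+ : ∀ {n} (f g : Fin n → ℚ) → Σℚ (λ i → f i + g i) ≡ Σℚ f + Σℚ g
Σℚ-+ {zero} f g = refl
Σℚ-+ {suc n} f g = trans (cong (_+_ (f zero + g zero)) (Σℚ-+ (λ i → f (suc i)) (λ i → g (suc i))))
  (solve 4 (λ a b c d → (a :+ b) :+ (c :+ d) := (a :+ c) :+ (b :+ d)) refl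
    (f zero) (g zero) (Σℚ (λ i → f (suc i))) (Σℚ (λ i → g (suc i))))

*-distribˡ-Σℚ : ∀ {n} (a : ℚ) (f : Fin n → ℚ) → Σℚ (λ i → a * f i) ≡ a * Σℚ f
*-distribˡ-Σℚ {zero} a f = sym (ℚₚ.*-zeroʳ a)
*-distribˡ-Σℚ {suc n} a f =
  trans (cong (_+_ (a * f zero)) (*-distribˡ-Σℚ a (λ i → f (suc i)))) (sym (ℚₚ.*-distribˡ-+ a _ _))

Σℚ-neg : ∀ {n} (f : Fin n → ℚ) → Σℚ (λ i → - f i) ≡ - Σℚ f
Σℚ-neg f = begin
  Σℚ (λ i → - f i)         ≡⟨ Σℚ-cong (λ i → solve 1 (λ x → :- x := con (- 1ℚ) :* x) refl (f i)) ⟩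
  Σℚ (λ i → - 1ℚ * f i)    ≡⟨ *-distribˡ-Σℚ (- 1ℚ) f ⟩
  - 1ℚ * Σℚ f              ≡⟨ solve 1 (λ x → con (- 1ℚ) :* x := :- x) refl (Σℚ f) ⟩
  - Σℚ f                   ∎
  where open ≡-Reasoning

Σℚ-minus : ∀ {n} (f g : Fin n → ℚ) → Σℚ (λ i → f i - g i) ≡ Σℚ f - Σℚ g
Σℚ-minus f g = trans (Σℚ-+ f (λ i → - g i)) (cong (_+_ (Σℚ f)) (Σℚ-neg g))

Σℚ-comm : ∀ {m n} (f : Fin m → Fin n → ℚ) → Σℚ (λ i → Σℚ (λ j → f i j)) ≡ Σℚ (λ j → Σℚ (λ i → f i j))
Σℚ-comm {zero} {n} f = sym (Σℚ-0 n)
Σℚ-comm {suc m} f = trans (cong (_+_ (Σℚ (f zero))) (Σℚ-comm (λ i → f (suc i))))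
  (sym (Σℚ-+ (f zero) (λ j → Σℚ (λ i → f (suc i) j))))

Σℚ-single : ∀ {n} (f : Fin n → ℚ) k → (∀ i → i ≢ k → f i ≡ 0ℚ) → Σℚ f ≡ f k
Σℚ-single {suc n} f zero f≡0 =
  trans (cong (_+_ (f zero)) (trans (Σℚ-cong (λ i → f≡0 (suc i) λ ())) (Σℚ-0 n))) (ℚₚ.+-identityʳ (f zero))
Σℚ-single {suc n} f (suc k) f≡0 =
  trans (cong (_+ Σℚ (λ i → f (suc i))) (f≡0 zero λ ()))
    (trans (ℚₚ.+-identityˡ _)
      (Σℚ-single (λ i → f (suc i)) k (λ i i≢k → f≡0 (suc i) (i≢k ∘ Finₚ.suc-injective))))

Σℚ-basis-* : ∀ {n} (a : Fin n) (f : Fin n → ℚ) → Σℚ (λ i → basis a i * f i) ≡ f a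
Σℚ-basis-* a f =
  trans (Σℚ-single _ a (λ i i≢a → trans (cong (_* f i) (indicator-no (i ≟ᶠ a) i≢a)) (ℚₚ.*-zeroˡ (f i))))
    (trans (cong (_* f a) (indicator-yes (a ≟ᶠ a) refl)) (ℚₚ.*-identityˡ (f a)))

Σℚ-*-basis : ∀ {n} (x : Fin n → ℚ) k → Σℚ (λ i → x i * basis i k) ≡ x k
Σℚ-*-basis x k =
  trans (Σℚ-single _ k (λ i i≢k → trans (cong (x i *_) (indicator-no (k ≟ᶠ i) (i≢k ∘ sym))) (ℚₚ.*-zeroʳ (x i))))
    (trans (cong (x k *_) (indicator-yes (k ≟ᶠ k) refl)) (ℚₚ.*-identityʳ (x k)))

IsInt-Σℚ : ∀ {n} (f : Fin n → ℚ) → (∀ i → IsInt (f i)) → IsInt (Σℚ f)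
IsInt-Σℚ {zero} f f∈ℤ = IsInt-0
IsInt-Σℚ {suc n} f f∈ℤ = IsInt-+ (f∈ℤ zero) (IsInt-Σℚ (λ i → f (suc i)) (λ i → f∈ℤ (suc i)))

ℕ→ℚ-length-filter : ∀ {n} {A : Set} {P : A → Set} (P? : ∀ a → Dec (P a)) (f : Fin n → A) →
  ℕ→ℚ (length (filter P? (tabulate f))) ≡ Σℚ (λ i → indicator (P? (f i)))
ℕ→ℚ-length-filter {zero} P? f = refl
ℕ→ℚ-length-filter {suc n} P? f with P? (f zero)
... | yes _ = trans (ℕ→ℚ-homo-+ 1 (length (filter P? (tabulate (λ i → f (suc i))))))
                    (cong (_+_ 1ℚ) (ℕ→ℚ-length-filter P? (λ i → f (suc i))))
... | no _ = trans (ℕ→ℚ-length-filter P? (λ i → f (suc i))) (sym (ℚₚ.+-identityˡ _))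

length-filter-tabulate-pos : ∀ {n} {A : Set} {P : A → Set} (P? : ∀ a → Dec (P a)) (f : Fin n → A) i →
  P (f i) → 1 ≤ length (filter P? (tabulate f))
length-filter-tabulate-pos P? f zero p with P? (f zero)
... | yes _ = s≤s z≤n
... | no ¬p = ⊥-elim (¬p p)
length-filter-tabulate-pos P? f (suc i) p with P? (f zero)
... | yes _ = s≤s z≤n
... | no _ = length-filter-tabulate-pos P? (λ j → f (suc j)) i p

gcdList-∣ : ∀ {n ns} → n ∈ ns → gcdList ns ∣ n
gcdList-∣ {ns = m ∷ ms} (here refl) = gcd[m,n]∣m m (gcdList ms)
gcdList-∣ {ns = m ∷ ms} (there n∈ms) = ∣-trans (gcd[m,n]∣n m (gcdList ms)) (gcdList-∣ n∈ms)

DenominatorDivides : ℚ → ℕ → Set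
DenominatorDivides t n = IsInt (t * ℕ→ℚ n)

DenominatorDivides-0 : ∀ t → DenominatorDivides t 0
DenominatorDivides-0 t = IsInt-resp (ℚₚ.*-zeroʳ t) IsInt-0

DenominatorDivides-linear : ∀ t {d a b} x y → d ℕ.+ y ℕ.* b ≡ x ℕ.* a →
  DenominatorDivides t a → DenominatorDivides t b → DenominatorDivides t d
DenominatorDivides-linear t {d} {a} {b} x y d+yb≡xa ta∈ℤ tb∈ℤ =
  IsInt-resp td≡ (IsInt-minus (IsInt-* (IsInt-ℤ→ℚ (+ x)) ta∈ℤ) (IsInt-* (IsInt-ℤ→ℚ (+ y)) tb∈ℤ))
  where
  open ≡-Reasoning
  D = ℕ→ℚ d
  A = ℕ→ℚ a
  B = ℕ→ℚ b
  X = ℕ→ℚ x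
  Y = ℕ→ℚ y
  D+YB≡XA : D + Y * B ≡ X * A
  D+YB≡XA = begin
    D + Y * B           ≡⟨ sym (trans (ℕ→ℚ-homo-+ d (y ℕ.* b)) (cong (_+_ D) (ℕ→ℚ-homo-* y b))) ⟩
    ℕ→ℚ (d ℕ.+ y ℕ.* b) ≡⟨ cong ℕ→ℚ d+yb≡xa ⟩
    ℕ→ℚ (x ℕ.* a)       ≡⟨ ℕ→ℚ-homo-* x a ⟩
    X * A               ∎
  td≡ : t * D ≡ X * (t * A) - Y * (t * B)
  td≡ = begin
    t * D                     ≡⟨ solve 4 (λ t D Y B → t :* D := t :* ((D :+ Y :* B) :- Y :* B)) refl t D Y B ⟩
    t * ((D + Y * B) - Y * B) ≡⟨ cong (λ z → t * (z - Y * B)) D+YB≡XA ⟩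
    t * (X * A - Y * B)
      ≡⟨ solve 5 (λ t X A Y B → t :* (X :* A :- Y :* B) := X :* (t :* A) :- Y :* (t :* B)) refl t X A Y B ⟩
    X * (t * A) - Y * (t * B) ∎

DenominatorDivides-gcd : ∀ t m n →
  DenominatorDivides t m → DenominatorDivides t n → DenominatorDivides t (gcd m n)
DenominatorDivides-gcd t m n tm∈ℤ tn∈ℤ with Bézout.identity (gcd-GCD m n)
... | Bézout.+- x y eq = DenominatorDivides-linear t x y eq tm∈ℤ tn∈ℤ
... | Bézout.-+ x y eq = DenominatorDivides-linear t y x eq tn∈ℤ tm∈ℤ

DenominatorDivides-gcdList : ∀ t ns →
  (∀ {n} → n ∈ ns → DenominatorDivides t n) → DenominatorDivides t (gcdList ns)
DenominatorDivides-gcdList t [] _ = DenominatorDivides-0 t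
DenominatorDivides-gcdList t (m ∷ ms) clears =
  DenominatorDivides-gcd t m (gcdList ms) (clears (here refl)) (DenominatorDivides-gcdList t ms (clears ∘ there))

m-n≡q*d⇒m≡n : ∀ {m n d} q → m ℕ.< d → n ℕ.< d → + m ℤ.- + n ≡ q ℤ.* + d → m ≡ n
m-n≡q*d⇒m≡n {m} {n} (+ zero) _ _ m-n≡0 = ℤₚ.+-injective (ℤₚ.i-j≡0⇒i≡j (+ m) (+ n) m-n≡0)
m-n≡q*d⇒m≡n {m} {n} {d} (+ suc q) m<d _ m-n≡ = ⊥-elim (ℕₚ.<⇒≱ m<d d≤m)
  where
  i≡i-j+j : ∀ i j → i ≡ (i ℤ.- j) ℤ.+ j
  i≡i-j+j = solve-∀
  m≡ : + m ≡ + (suc q ℕ.* d ℕ.+ n)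
  m≡ = trans (i≡i-j+j (+ m) (+ n)) (cong (ℤ._+ + n) (trans m-n≡ (sym (ℤₚ.pos-* (suc q) d))))
  d≤m : d ≤ m
  d≤m = subst (d ≤_) (sym (ℤₚ.+-injective m≡)) (ℕₚ.≤-trans (ℕₚ.m≤n*m d (suc q)) (ℕₚ.m≤m+n _ n))
m-n≡q*d⇒m≡n {m} {n} {d} -[1+ q ] m<d n<d m-n≡ = sym (m-n≡q*d⇒m≡n (+ suc q) n<d m<d n-m≡)
  where
  neg-minus : ∀ i j → ℤ.- (i ℤ.- j) ≡ j ℤ.- i
  neg-minus = solve-∀
  n-m≡ : + n ℤ.- + m ≡ + suc q ℤ.* + d
  n-m≡ = trans (sym (neg-minus (+ m) (+ n))) (trans (cong ℤ.-_ m-n≡) (ℤₚ.neg-distribˡ-* -[1+ q ] (+ d)))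

module Span {v : ℕ} (B : List (Vecℚ v)) where

  lincomb-+ : ∀ (c d : Fin (length B) → ℚ) i → lincomb B (λ k → c k + d k) i ≡ lincomb B c i + lincomb B d i
  lincomb-+ c d i = trans (Σℚ-cong (λ k → ℚₚ.*-distribʳ-+ (lookup B k i) (c k) (d k)))
    (Σℚ-+ (λ k → c k * lookup B k i) (λ k → d k * lookup B k i))

  lincomb-* : ∀ a (c : Fin (length B) → ℚ) i → lincomb B (λ k → a * c k) i ≡ a * lincomb B c i
  lincomb-* a c i = trans (Σℚ-cong (λ k → ℚₚ.*-assoc a (c k) (lookup B k i)))
    (*-distribˡ-Σℚ a (λ k → c k * lookup B k i))

  lincomb-0 : ∀ i → lincomb B (λ _ → 0ℚ) i ≡ 0ℚ
  lincomb-0 i = trans (Σℚ-cong (λ k → ℚₚ.*-zeroˡ (lookup B k i))) (Σℚ-0 (length B))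

  lincomb-indicator : ∀ k₀ i → lincomb B (λ k → indicator (k ≟ᶠ k₀)) i ≡ lookup B k₀ i
  lincomb-indicator k₀ i =
    trans (Σℚ-single _ k₀ λ k k≢k₀ →
             trans (cong (_* lookup B k i) (indicator-no (k ≟ᶠ k₀) k≢k₀)) (ℚₚ.*-zeroˡ (lookup B k i)))
      (trans (cong (_* lookup B k₀ i) (indicator-yes (k₀ ≟ᶠ k₀) refl)) (ℚₚ.*-identityˡ (lookup B k₀ i)))

  InZSpan-resp : ∀ {x y} → x ≈ y → InZSpan B y → InZSpan B x
  InZSpan-resp x≈y (c , y≈) = c , λ i → trans (x≈y i) (y≈ i)

  InZSpan-0 : InZSpan B (λ _ → 0ℚ)
  InZSpan-0 = (λ _ → + 0) , λ i → sym (lincomb-0 i)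

  InZSpan-+ : ∀ {x y} → InZSpan B x → InZSpan B y → InZSpan B (λ i → x i + y i)
  InZSpan-+ (c , x≈) (d , y≈) = (λ k → c k ℤ.+ d k) , λ i →
    trans (cong₂ _+_ (x≈ i) (y≈ i))
      (trans (sym (lincomb-+ (λ k → ℤ→ℚ (c k)) (λ k → ℤ→ℚ (d k)) i))
        (Σℚ-cong (λ k → cong (_* lookup B k i) (sym (ℤ→ℚ-homo-+ (c k) (d k))))))

  InZSpan-* : ∀ z {x} → InZSpan B x → InZSpan B (λ i → ℤ→ℚ z * x i)
  InZSpan-* z (c , x≈) = (λ k → z ℤ.* c k) , λ i →
    trans (cong (ℤ→ℚ z *_) (x≈ i))
      (trans (sym (lincomb-* (ℤ→ℚ z) (λ k → ℤ→ℚ (c k)) i))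
        (Σℚ-cong (λ k → cong (_* lookup B k i) (sym (ℤ→ℚ-homo-* z (c k))))))

  InZSpan-neg : ∀ {x} → InZSpan B x → InZSpan B (λ i → - x i)
  InZSpan-neg {x} x∈ =
    InZSpan-resp (λ i → solve 1 (λ y → :- y := con (- 1ℚ) :* y) refl (x i)) (InZSpan-* (ℤ.- + 1) x∈)

  InZSpan-lookup : ∀ k → InZSpan B (lookup B k)
  InZSpan-lookup k₀ = (λ k → if does (k ≟ᶠ k₀) then + 1 else + 0) , λ i →
    trans (sym (lincomb-indicator k₀ i)) (Σℚ-cong (λ k → cong (_* lookup B k i) (indicator≡ℤ→ℚ (k ≟ᶠ k₀))))
    where
    indicator≡ℤ→ℚ : ∀ {a} {P : Set a} (d : Dec P) → indicator d ≡ ℤ→ℚ (if does d then + 1 else + 0)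
    indicator≡ℤ→ℚ (yes _) = refl
    indicator≡ℤ→ℚ (no _) = refl

  InZSpan-Σℚ : ∀ {m} (f : Fin m → Vecℚ v) → (∀ j → InZSpan B (f j)) → InZSpan B (λ i → Σℚ (λ j → f j i))
  InZSpan-Σℚ {zero} f f∈ = InZSpan-0
  InZSpan-Σℚ {suc m} f f∈ = InZSpan-+ (f∈ zero) (InZSpan-Σℚ (λ j → f (suc j)) (λ j → f∈ (suc j)))

  InZSpan⇒InSpan : ∀ {x} → InZSpan B x → InSpan B x
  InZSpan⇒InSpan (c , x≈) = (λ k → ℤ→ℚ (c k)) , x≈

  InZSpan⇒IsInt : (∀ k i → IsInt (lookup B k i)) → ∀ {x} → InZSpan B x → ∀ i → IsInt (x i)
  InZSpan⇒IsInt B∈ℤ (c , x≈) i = IsInt-resp (x≈ i) (IsInt-Σℚ _ (λ k → IsInt-* (IsInt-ℤ→ℚ (c k)) (B∈ℤ k i)))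

  InSpan-resp : ∀ {x y} → x ≈ y → InSpan B y → InSpan B x
  InSpan-resp x≈y (c , y≈) = c , λ i → trans (x≈y i) (y≈ i)

  InSpan-0 : InSpan B (λ _ → 0ℚ)
  InSpan-0 = (λ _ → 0ℚ) , λ i → sym (lincomb-0 i)

  InSpan-+ : ∀ {x y} → InSpan B x → InSpan B y → InSpan B (λ i → x i + y i)
  InSpan-+ (c , x≈) (d , y≈) = (λ k → c k + d k) , λ i → trans (cong₂ _+_ (x≈ i) (y≈ i)) (sym (lincomb-+ c d i))

  InSpan-* : ∀ a {x} → InSpan B x → InSpan B (λ i → a * x i)
  InSpan-* a (c , x≈) = (λ k → a * c k) , λ i → trans (cong (a *_) (x≈ i)) (sym (lincomb-* a c i))

  InSpan-Σℚ : ∀ {m} (f : Fin m → Vecℚ v) → (∀ j → InSpan B (f j)) → InSpan B (λ i → Σℚ (λ j → f j i))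
  InSpan-Σℚ {zero} f f∈ = InSpan-0
  InSpan-Σℚ {suc m} f f∈ = InSpan-+ (f∈ zero) (InSpan-Σℚ (λ j → f (suc j)) (λ j → f∈ (suc j)))

  InSpan⇒annihilated : ∀ (φ : Fin v → ℚ) → (∀ k → Σℚ (λ i → lookup B k i * φ i) ≡ 0ℚ) →
    ∀ {x} → InSpan B x → Σℚ (λ i → x i * φ i) ≡ 0ℚ
  InSpan⇒annihilated φ φB≡0 {x} (c , x≈) = begin
    Σℚ (λ i → x i * φ i)
      ≡⟨ Σℚ-cong (λ i → cong (_* φ i) (x≈ i)) ⟩
    Σℚ (λ i → lincomb B c i * φ i)
      ≡⟨ Σℚ-cong (λ i → trans (ℚₚ.*-comm _ (φ i)) (sym (*-distribˡ-Σℚ (φ i) (λ k → c k * lookup B k i)))) ⟩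
    Σℚ (λ i → Σℚ (λ k → φ i * (c k * lookup B k i)))
      ≡⟨ Σℚ-comm (λ i k → φ i * (c k * lookup B k i)) ⟩
    Σℚ (λ k → Σℚ (λ i → φ i * (c k * lookup B k i)))
      ≡⟨ Σℚ-cong (λ k → trans (Σℚ-cong λ i → solve 3 (λ a b d → a :* (b :* d) := b :* (d :* a)) refl
                                                        (φ i) (c k) (lookup B k i))
                                (*-distribˡ-Σℚ (c k) (λ i → lookup B k i * φ i))) ⟩
    Σℚ (λ k → c k * Σℚ (λ i → lookup B k i * φ i))
      ≡⟨ Σℚ-cong (λ k → trans (cong (c k *_) (φB≡0 k)) (ℚₚ.*-zeroʳ (c k))) ⟩
    Σℚ (λ (k : Fin (length B)) → 0ℚ)
      ≡⟨ Σℚ-0 (length B) ⟩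
    0ℚ ∎
    where open ≡-Reasoning

module Components {v : ℕ} (G : SimpleGraph v) {c : ℕ} (L : ComponentLabelling G c) where

  open Span A[ G ]

  edgeVector : Fin v × Fin v → Vecℚ v
  edgeVector e = basis (proj₁ e) ⊖ basis (proj₂ e)

  χ : Fin c → Fin v → ℚ
  χ m i = indicator (label L i ≟ᶠ m)

  componentSum : Fin c → Vecℚ v → ℚ
  componentSum m x = Σℚ (λ i → x i * χ m i)

  root : Fin c → Fin v
  root m = proj₁ (onto L m)

  label-root : ∀ m → label L (root m) ≡ m
  label-root m = proj₂ (onto L m)

  rootOf : Fin v → Fin v
  rootOf i = root (label L i)

  label-rootOf : ∀ i → label L (rootOf i) ≡ label L i
  label-rootOf i = label-root (label L i)

  edge⇒sameLabel : ∀ {a b} → (a , b) ∈ edges G → label L a ≡ label L b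
  edge⇒sameLabel ab∈G = Equivalence.from (sameComp L _ _) (inj₁ ab∈G ◅ ε)

  edge∈ZSpan : ∀ {a b} → (a , b) ∈ edges G → InZSpan A[ G ] (basis a ⊖ basis b)
  edge∈ZSpan ab∈G = InZSpan-resp (λ i → cong (λ y → y i) (lookup-index p)) (InZSpan-lookup (Any.index p))
    where p = ∈-map⁺ edgeVector ab∈G

  adjacent∈ZSpan : ∀ {a b} → Adj G a b → InZSpan A[ G ] (basis a ⊖ basis b)
  adjacent∈ZSpan (inj₁ ab∈G) = edge∈ZSpan ab∈G
  adjacent∈ZSpan {a} {b} (inj₂ ba∈G) =
    InZSpan-resp (λ i → solve 2 (λ x y → x :- y := :- (y :- x)) refl (basis a i) (basis b i))
      (InZSpan-neg (edge∈ZSpan ba∈G))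

  connected∈ZSpan : ∀ {a b} → Connected G a b → InZSpan A[ G ] (basis a ⊖ basis b)
  connected∈ZSpan {a} ε = InZSpan-resp (λ i → ℚₚ.+-inverseʳ (basis a i)) InZSpan-0
  connected∈ZSpan {a} {b} (_◅_ {j = m} a~m m~b) =
    InZSpan-resp (λ i → solve 3 (λ x y z → x :- z := (x :- y) :+ (y :- z)) refl
                                (basis a i) (basis m i) (basis b i))
      (InZSpan-+ (adjacent∈ZSpan a~m) (connected∈ZSpan m~b))

  rootOf∈ZSpan : ∀ i → InZSpan A[ G ] (basis i ⊖ basis (rootOf i))
  rootOf∈ZSpan i = connected∈ZSpan (Equivalence.to (sameComp L i (rootOf i)) (sym (label-rootOf i)))

  lookup-A : ∀ k → Σ (Fin v × Fin v) λ e → e ∈ edges G × lookup A[ G ] k ≡ edgeVector e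
  lookup-A k = ∈-map⁻ edgeVector {xs = edges G} (∈-lookup {xs = A[ G ]} k)

  A-integral : ∀ k i → IsInt (lookup A[ G ] k i)
  A-integral k i with lookup-A k
  ... | (a , b) , _ , eq =
    IsInt-resp (cong (λ y → y i) eq) (IsInt-minus (IsInt-indicator (i ≟ᶠ a)) (IsInt-indicator (i ≟ᶠ b)))

  componentSum-⊖ : ∀ m x y → componentSum m (x ⊖ y) ≡ componentSum m x - componentSum m y
  componentSum-⊖ m x y =
    trans (Σℚ-cong (λ i → solve 3 (λ a b h → (a :- b) :* h := a :* h :- b :* h) refl (x i) (y i) (χ m i)))
      (Σℚ-minus (λ i → x i * χ m i) (λ i → y i * χ m i))

  componentSum-edge : ∀ m {a b} → label L a ≡ label L b → componentSum m (basis a ⊖ basis b) ≡ 0ℚ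
  componentSum-edge m {a} {b} same = begin
    componentSum m (basis a ⊖ basis b)                  ≡⟨ componentSum-⊖ m (basis a) (basis b) ⟩
    componentSum m (basis a) - componentSum m (basis b) ≡⟨ cong₂ _-_ (Σℚ-basis-* a (χ m)) (Σℚ-basis-* b (χ m)) ⟩
    χ m a - χ m b                                       ≡⟨ cong (λ l → indicator (l ≟ᶠ m) - χ m b) same ⟩
    χ m b - χ m b                                       ≡⟨ ℚₚ.+-inverseʳ (χ m b) ⟩
    0ℚ                                                  ∎
    where open ≡-Reasoning

  InSpan⇒componentSum≡0 : ∀ {x} → InSpan A[ G ] x → ∀ m → componentSum m x ≡ 0ℚ
  InSpan⇒componentSum≡0 x∈ m = InSpan⇒annihilated (χ m) generator x∈
    where
    generator : ∀ k → componentSum m (lookup A[ G ] k) ≡ 0ℚ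
    generator k with lookup-A k
    ... | (a , b) , ab∈G , eq =
      trans (Σℚ-cong (λ i → cong (λ y → y i * χ m i) eq)) (componentSum-edge m (edge⇒sameLabel ab∈G))

  basis-rootOf : ∀ i k → basis (rootOf i) k ≡ basis (rootOf k) k * χ (label L k) i
  basis-rootOf i k with k ≟ᶠ rootOf i
  ... | yes k≡rootOf-i = sym (trans (cong₂ _*_ (indicator-yes (k ≟ᶠ rootOf k) k≡rootOf-k)
                                            (indicator-yes (label L i ≟ᶠ label L k) (sym same)))
                                 (ℚₚ.*-identityˡ 1ℚ))
    where
    same : label L k ≡ label L i
    same = trans (cong (label L) k≡rootOf-i) (label-rootOf i)
    k≡rootOf-k : k ≡ rootOf k
    k≡rootOf-k = trans k≡rootOf-i (cong root (sym same))
  ... | no k≢rootOf-i with label L i ≟ᶠ label L k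
  ...   | yes same = sym (trans (cong (_* 1ℚ) (indicator-no (k ≟ᶠ rootOf k) λ k≡ →
                                                   k≢rootOf-i (trans k≡ (cong root (sym same)))))
                                (ℚₚ.*-zeroˡ 1ℚ))
  ...   | no _ = sym (ℚₚ.*-zeroʳ (basis (rootOf k) k))

  decomposition : ∀ {x} → (∀ m → componentSum m x ≡ 0ℚ) →
    x ≈ (λ k → Σℚ (λ i → x i * (basis i ⊖ basis (rootOf i)) k))
  decomposition {x} sums≡0 k = sym (begin
    Σℚ (λ i → x i * (basis i k - basis (rootOf i) k))
      ≡⟨ Σℚ-cong (λ i → solve 3 (λ a p q → a :* (p :- q) := a :* p :- a :* q) refl
                                (x i) (basis i k) (basis (rootOf i) k)) ⟩
    Σℚ (λ i → x i * basis i k - x i * basis (rootOf i) k)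
      ≡⟨ Σℚ-minus (λ i → x i * basis i k) (λ i → x i * basis (rootOf i) k) ⟩
    Σℚ (λ i → x i * basis i k) - Σℚ (λ i → x i * basis (rootOf i) k)
      ≡⟨ cong₂ _-_ (Σℚ-*-basis x k) (Σℚ-cong (λ i → cong (x i *_) (basis-rootOf i k))) ⟩
    x k - Σℚ (λ i → x i * (β * χ (label L k) i))
      ≡⟨ cong (_-_ (x k)) (trans (Σℚ-cong λ i → solve 3 (λ a b h → a :* (b :* h) := b :* (a :* h)) refl
                                                         (x i) β (χ (label L k) i))
                                 (*-distribˡ-Σℚ β (λ i → x i * χ (label L k) i))) ⟩
    x k - β * componentSum (label L k) x
      ≡⟨ cong (λ s → x k - β * s) (sums≡0 (label L k)) ⟩
    x k - β * 0ℚ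
      ≡⟨ solve 2 (λ a b → a :- b :* con 0ℚ := a) refl (x k) β ⟩
    x k ∎)
    where
    open ≡-Reasoning
    β = basis (rootOf k) k

  componentSums≡0⇒InZSpan : ∀ {x} → (∀ i → IsInt (x i)) → (∀ m → componentSum m x ≡ 0ℚ) → InZSpan A[ G ] x
  componentSums≡0⇒InZSpan {x} x∈ℤ sums≡0 =
    InZSpan-resp (decomposition sums≡0) (InZSpan-Σℚ (λ i k → x i * (basis i ⊖ basis (rootOf i)) k) term∈)
    where
    term∈ : ∀ i → InZSpan A[ G ] (λ k → x i * (basis i ⊖ basis (rootOf i)) k)
    term∈ i = InZSpan-resp (λ k → cong (_* (basis i ⊖ basis (rootOf i)) k) (proj₂ (x∈ℤ i)))
                           (InZSpan-* (proj₁ (x∈ℤ i)) (rootOf∈ZSpan i))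

  componentSums≡0⇒InSpan : ∀ {x} → (∀ m → componentSum m x ≡ 0ℚ) → InSpan A[ G ] x
  componentSums≡0⇒InSpan {x} sums≡0 =
    InSpan-resp (decomposition sums≡0)
      (InSpan-Σℚ (λ i k → x i * (basis i ⊖ basis (rootOf i)) k)
                 (λ i → InSpan-* (x i) (InZSpan⇒InSpan (rootOf∈ZSpan i))))

  Σℚ-root : ∀ m (f : Fin v → ℚ) → Σℚ (λ i → basis (rootOf i) i * f i * χ m i) ≡ f (root m)
  Σℚ-root m f = trans (Σℚ-single (λ i → basis (rootOf i) i * f i * χ m i) (root m) off-root) at-root
    where
    off-root : ∀ i → i ≢ root m → basis (rootOf i) i * f i * χ m i ≡ 0ℚ
    off-root i i≢root with label L i ≟ᶠ m
    ... | no _ = ℚₚ.*-zeroʳ (basis (rootOf i) i * f i)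
    ... | yes same = trans (cong (λ y → y * f i * 1ℚ) (indicator-no (i ≟ᶠ rootOf i) λ i≡ →
                                                            i≢root (trans i≡ (cong root same))))
                           (trans (ℚₚ.*-identityʳ (0ℚ * f i)) (ℚₚ.*-zeroˡ (f i)))
    at-root : basis (rootOf (root m)) (root m) * f (root m) * χ m (root m) ≡ f (root m)
    at-root = trans (cong₂ (λ y z → y * f (root m) * z)
                           (indicator-yes (root m ≟ᶠ rootOf (root m)) (sym (cong root (label-root m))))
                           (indicator-yes (label L (root m) ≟ᶠ m) (label-root m)))
                    (trans (ℚₚ.*-identityʳ (1ℚ * f (root m))) (ℚₚ.*-identityˡ (f (root m))))

  Σℚ-χ : ∀ i → Σℚ (λ m → χ m i) ≡ 1ℚ
  Σℚ-χ i = trans (Σℚ-single (λ m → χ m i) (label L i) λ m m≢ → indicator-no (label L i ≟ᶠ m) (m≢ ∘ sym))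
                 (indicator-yes (label L i ≟ᶠ label L i) refl)

  componentSums≡0⇒Σℚ≡0 : ∀ {x} → (∀ m → componentSum m x ≡ 0ℚ) → Σℚ x ≡ 0ℚ
  componentSums≡0⇒Σℚ≡0 {x} sums≡0 = begin
    Σℚ x                                   ≡⟨ Σℚ-cong (λ i → sym (trans (cong (x i *_) (Σℚ-χ i)) (ℚₚ.*-identityʳ (x i)))) ⟩
    Σℚ (λ i → x i * Σℚ (λ m → χ m i))      ≡⟨ Σℚ-cong (λ i → sym (*-distribˡ-Σℚ (x i) (λ m → χ m i))) ⟩
    Σℚ (λ i → Σℚ (λ m → x i * χ m i))      ≡⟨ Σℚ-comm (λ i m → x i * χ m i) ⟩
    Σℚ (λ m → componentSum m x)            ≡⟨ Σℚ-cong sums≡0 ⟩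
    Σℚ {c} (λ _ → 0ℚ)                      ≡⟨ Σℚ-0 c ⟩
    0ℚ                                     ∎
    where open ≡-Reasoning

  ℕ→ℚ-compSize : ∀ m → ℕ→ℚ (compSize L m) ≡ Σℚ (χ m)
  ℕ→ℚ-compSize m = ℕ→ℚ-length-filter (λ i → label L i ≟ᶠ m) (λ i → i)

  compGcd∣compSize : ∀ m → compGcd L ∣ compSize L m
  compGcd∣compSize m = gcdList-∣ (∈-map⁺ (compSize L) (∈-allFin m))

  compGcd≡suc : Fin v → Σ ℕ λ g-1 → compGcd L ≡ suc g-1
  compGcd≡suc i with compGcd L | compGcd∣compSize (label L i)
  ... | suc g-1 | _ = g-1 , refl
  ... | zero | 0∣size = ⊥-elim (ℕₚ.<⇒≢ size>0 (sym (0∣⇒≡0 0∣size)))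
    where
    size>0 : 0 ℕ.< compSize L (label L i)
    size>0 = length-filter-tabulate-pos (λ j → label L j ≟ᶠ label L i) (λ j → j) i refl

  rootMultiplicity : HasIndex RootLattice A[ G ] 1
  rootMultiplicity = (λ _ _ → 0ℚ) , (λ _ → InSpan-0 , (λ _ → IsInt-0) , Σℚ-0 v) , cosets
    where
    x⊖0≈x : ∀ (x : Vecℚ v) → (x ⊖ (λ _ → 0ℚ)) ≈ x
    x⊖0≈x x i = solve 1 (λ y → y :- con 0ℚ := y) refl (x i)
    cosets : ∀ x → InSpan A[ G ] x → RootLattice x →
      Σ (Fin 1) λ k → InZSpan A[ G ] (x ⊖ (λ _ → 0ℚ)) × (∀ k′ → InZSpan A[ G ] (x ⊖ (λ _ → 0ℚ)) → k′ ≡ k)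
    cosets x x∈span (x∈ℤ , _) =
      zero , InZSpan-resp (x⊖0≈x x) (componentSums≡0⇒InZSpan x∈ℤ (InSpan⇒componentSum≡0 x∈span)) , λ { zero _ → refl }

  module WeightCosets (g-1 : ℕ) (compGcd≡g : compGcd L ≡ suc g-1) where

    g : ℕ
    g = suc g-1

    g∣compSize : ∀ m → g ∣ compSize L m
    g∣compSize m = subst (_∣ compSize L m) compGcd≡g (compGcd∣compSize m)

    size/g : Fin c → ℕ
    size/g m = _∣_.quotient (g∣compSize m)

    g⁻¹ : ℚ
    g⁻¹ = 1/ integer (+ g)

    *g*g⁻¹ : ∀ s → s * ℕ→ℚ g * g⁻¹ ≡ s
    *g*g⁻¹ s = begin
      s * ℕ→ℚ g * g⁻¹           ≡⟨ ℚₚ.*-assoc s (ℕ→ℚ g) g⁻¹ ⟩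
      s * (ℕ→ℚ g * g⁻¹)         ≡⟨ cong (λ y → s * (y * g⁻¹)) (ℤ→ℚ≡integer (+ g)) ⟩
      s * (integer (+ g) * g⁻¹) ≡⟨ cong (s *_) (ℚₚ.*-inverseʳ (integer (+ g))) ⟩
      s * 1ℚ                    ≡⟨ ℚₚ.*-identityʳ s ⟩
      s                         ∎
      where open ≡-Reasoning

    τ : Fin g → ℚ
    τ k = ℕ→ℚ (toℕ k) * g⁻¹

    -- basis (rootOf i) i is 1 exactly at the roots, so r k = (k/g)(1,…,1) − Σ_m (k v_m/g) e_(root m).
    correction : Fin g → Vecℚ v
    correction k i = basis (rootOf i) i * ℕ→ℚ (toℕ k ℕ.* size/g (label L i))

    r : Fin g → Vecℚ v
    r k i = τ k - correction k i

    IsInt-correction : ∀ k i → IsInt (correction k i)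
    IsInt-correction k i =
      IsInt-* (IsInt-indicator (i ≟ᶠ rootOf i)) (IsInt-ℤ→ℚ (+ (toℕ k ℕ.* size/g (label L i))))

    componentSum-τ : ∀ k m → componentSum m (λ _ → τ k) ≡ ℕ→ℚ (toℕ k ℕ.* size/g m)
    componentSum-τ k m = begin
      Σℚ (λ i → τ k * χ m i)                   ≡⟨ *-distribˡ-Σℚ (τ k) (χ m) ⟩
      τ k * Σℚ (χ m)                           ≡⟨ cong (τ k *_) (sym (ℕ→ℚ-compSize m)) ⟩
      τ k * ℕ→ℚ (compSize L m)                 ≡⟨ cong (λ n → τ k * ℕ→ℚ n) (_∣_.equality (g∣compSize m)) ⟩
      τ k * ℕ→ℚ (size/g m ℕ.* g)               ≡⟨ cong (τ k *_) (ℕ→ℚ-homo-* (size/g m) g) ⟩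
      K * g⁻¹ * (Q * ℕ→ℚ g)                    ≡⟨ solve 4 (λ K w Q G → K :* w :* (Q :* G) := K :* Q :* G :* w) refl
                                                          K g⁻¹ Q (ℕ→ℚ g) ⟩
      K * Q * ℕ→ℚ g * g⁻¹                      ≡⟨ *g*g⁻¹ (K * Q) ⟩
      K * Q                                    ≡⟨ sym (ℕ→ℚ-homo-* (toℕ k) (size/g m)) ⟩
      ℕ→ℚ (toℕ k ℕ.* size/g m)                 ∎
      where
      open ≡-Reasoning
      K = ℕ→ℚ (toℕ k)
      Q = ℕ→ℚ (size/g m)

    componentSum-correction : ∀ k m → componentSum m (correction k) ≡ ℕ→ℚ (toℕ k ℕ.* size/g m)
    componentSum-correction k m =
      trans (Σℚ-root m (λ i → ℕ→ℚ (toℕ k ℕ.* size/g (label L i))))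
            (cong (λ l → ℕ→ℚ (toℕ k ℕ.* size/g l)) (label-root m))

    componentSum-r : ∀ k m → componentSum m (r k) ≡ 0ℚ
    componentSum-r k m = begin
      componentSum m (r k)                                       ≡⟨ componentSum-⊖ m (λ _ → τ k) (correction k) ⟩
      componentSum m (λ _ → τ k) - componentSum m (correction k)
        ≡⟨ cong₂ _-_ (componentSum-τ k m) (componentSum-correction k m) ⟩
      ℕ→ℚ (toℕ k ℕ.* size/g m) - ℕ→ℚ (toℕ k ℕ.* size/g m)       ≡⟨ ℚₚ.+-inverseʳ (ℕ→ℚ (toℕ k ℕ.* size/g m)) ⟩
      0ℚ                                                         ∎
      where open ≡-Reasoning

    r-weight : ∀ k → WeightLattice (r k)
    r-weight k = componentSums≡0⇒Σℚ≡0 (componentSum-r k) , τ k , λ i →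
      IsInt-resp (solve 2 (λ t y → (t :- y) :- t := :- y) refl (τ k) (correction k i))
                 (IsInt-neg (IsInt-correction k i))

    τ-surjective-modℤ : ∀ t → DenominatorDivides t g → Σ (Fin g) λ k → IsInt (t - τ k)
    τ-surjective-modℤ t (M , tg≡M) = k , M /ℕ g , t-τk≡
      where
      open ≡-Reasoning
      k : Fin g
      k = fromℕ< (n%ℕd<d M g)
      R = ℕ→ℚ (M %ℕ g)
      Q = ℤ→ℚ (M /ℕ g)
      t-τk≡ : t - τ k ≡ Q
      t-τk≡ = begin
        t - τ k                              ≡⟨ cong (_- τ k) (sym (*g*g⁻¹ t)) ⟩
        t * ℕ→ℚ g * g⁻¹ - τ k                ≡⟨ cong (λ s → s * g⁻¹ - τ k) tg≡M ⟩
        ℤ→ℚ M * g⁻¹ - τ k                    ≡⟨ cong (λ z → ℤ→ℚ z * g⁻¹ - τ k) (a≡a%ℕn+[a/ℕn]*n M g) ⟩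
        ℤ→ℚ (+ (M %ℕ g) ℤ.+ M /ℕ g ℤ.* + g) * g⁻¹ - ℕ→ℚ (toℕ k) * g⁻¹
          ≡⟨ cong₂ (λ z n → z * g⁻¹ - ℕ→ℚ n * g⁻¹)
                   (trans (ℤ→ℚ-homo-+ (+ (M %ℕ g)) (M /ℕ g ℤ.* + g)) (cong (_+_ R) (ℤ→ℚ-homo-* (M /ℕ g) (+ g))))
                   (Finₚ.toℕ-fromℕ< (n%ℕd<d M g)) ⟩
        (R + Q * ℕ→ℚ g) * g⁻¹ - R * g⁻¹
          ≡⟨ solve 4 (λ R Q G w → (R :+ Q :* G) :* w :- R :* w := Q :* G :* w) refl R Q (ℕ→ℚ g) g⁻¹ ⟩
        Q * ℕ→ℚ g * g⁻¹                      ≡⟨ *g*g⁻¹ Q ⟩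
        Q                                    ∎

    τ-injective-modℤ : ∀ k k′ → IsInt (τ k - τ k′) → k ≡ k′
    τ-injective-modℤ k k′ (N , τk-τk′≡N) =
      Finₚ.toℕ-injective (m-n≡q*d⇒m≡n N (Finₚ.toℕ<n k) (Finₚ.toℕ<n k′) (ℤ→ℚ-injective k-k′≡Ng))
      where
      open ≡-Reasoning
      K = ℕ→ℚ (toℕ k)
      K′ = ℕ→ℚ (toℕ k′)
      k-k′≡Ng : ℤ→ℚ (+ toℕ k ℤ.- + toℕ k′) ≡ ℤ→ℚ (N ℤ.* + g)
      k-k′≡Ng = begin
        ℤ→ℚ (+ toℕ k ℤ.- + toℕ k′)
          ≡⟨ trans (ℤ→ℚ-homo-+ (+ toℕ k) (ℤ.- + toℕ k′)) (cong (_+_ K) (ℤ→ℚ-homo‿- (+ toℕ k′))) ⟩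
        K - K′                               ≡⟨ cong₂ _-_ (sym (*g*g⁻¹ K)) (sym (*g*g⁻¹ K′)) ⟩
        K * ℕ→ℚ g * g⁻¹ - K′ * ℕ→ℚ g * g⁻¹
          ≡⟨ solve 4 (λ a b G w → a :* G :* w :- b :* G :* w := (a :* w :- b :* w) :* G) refl K K′ (ℕ→ℚ g) g⁻¹ ⟩
        (τ k - τ k′) * ℕ→ℚ g                 ≡⟨ cong (_* ℕ→ℚ g) τk-τk′≡N ⟩
        ℤ→ℚ N * ℕ→ℚ g                        ≡⟨ sym (ℤ→ℚ-homo-* N (+ g)) ⟩
        ℤ→ℚ (N ℤ.* + g)                      ∎

    module _ {x : Vecℚ v} (x∈span : InSpan A[ G ] x) {t : ℚ} (x-t∈ℤ : ∀ i → IsInt (x i - t)) where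

      t·compSize∈ℤ : ∀ m → DenominatorDivides t (compSize L m)
      t·compSize∈ℤ m = IsInt-resp t*size≡ (IsInt-neg (IsInt-Σℚ (λ i → (x i - t) * χ m i) λ i →
                              IsInt-* (x-t∈ℤ i) (IsInt-indicator (label L i ≟ᶠ m))))
        where
        open ≡-Reasoning
        Sx = componentSum m x
        St = componentSum m (λ _ → t)
        t*size≡ : t * ℕ→ℚ (compSize L m) ≡ - componentSum m (λ i → x i - t)
        t*size≡ = begin
          t * ℕ→ℚ (compSize L m)                 ≡⟨ cong (t *_) (ℕ→ℚ-compSize m) ⟩
          t * Σℚ (χ m)                           ≡⟨ sym (*-distribˡ-Σℚ t (χ m)) ⟩
          St                                     ≡⟨ solve 2 (λ a b → b := a :- (a :- b)) refl Sx St ⟩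
          Sx - (Sx - St)
            ≡⟨ cong₂ _-_ (InSpan⇒componentSum≡0 x∈span m) (sym (componentSum-⊖ m x (λ _ → t))) ⟩
          0ℚ - componentSum m (λ i → x i - t)    ≡⟨ ℚₚ.+-identityˡ (- componentSum m (λ i → x i - t)) ⟩
          - componentSum m (λ i → x i - t)       ∎

      t·g∈ℤ : DenominatorDivides t g
      t·g∈ℤ =
        subst (DenominatorDivides t) compGcd≡g (DenominatorDivides-gcdList t (map (compSize L) (allFin c)) clears)
        where
        clears : ∀ {n} → n ∈ map (compSize L) (allFin c) → DenominatorDivides t n
        clears n∈ with ∈-map⁻ (compSize L) n∈
        ... | m , _ , refl = t·compSize∈ℤ m

      t-τk∈ℤ⇒x-rk∈ZSpan : ∀ k → IsInt (t - τ k) → InZSpan A[ G ] (x ⊖ r k)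
      t-τk∈ℤ⇒x-rk∈ZSpan k t-τk∈ℤ = componentSums≡0⇒InZSpan integral sums≡0
        where
        integral : ∀ i → IsInt (x i - r k i)
        integral i =
          IsInt-resp (solve 4 (λ x t a y → x :- (a :- y) := (x :- t) :+ (t :- a) :+ y) refl (x i) t (τ k) (correction k i))
                     (IsInt-+ (IsInt-+ (x-t∈ℤ i) t-τk∈ℤ) (IsInt-correction k i))
        sums≡0 : ∀ m → componentSum m (x ⊖ r k) ≡ 0ℚ
        sums≡0 m = trans (componentSum-⊖ m x (r k))
                     (trans (cong₂ _-_ (InSpan⇒componentSum≡0 x∈span m) (componentSum-r k m)) (ℚₚ.+-inverseʳ 0ℚ))

      x-rk∈ZSpan⇒t-τk∈ℤ : Fin v → ∀ k → InZSpan A[ G ] (x ⊖ r k) → IsInt (t - τ k)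
      x-rk∈ZSpan⇒t-τk∈ℤ i k x-rk∈ZSpan =
        IsInt-resp (solve 4 (λ x t a y → t :- a := (x :- (a :- y)) :- (x :- t) :- y) refl (x i) t (τ k) (correction k i))
          (IsInt-minus (IsInt-minus (InZSpan⇒IsInt A-integral x-rk∈ZSpan i) (x-t∈ℤ i)) (IsInt-correction k i))

    hasIndex : Fin v → HasIndex WeightLattice A[ G ] g
    hasIndex i = r , (λ k → componentSums≡0⇒InSpan (componentSum-r k) , r-weight k) , cosets
      where
      cosets : ∀ x → InSpan A[ G ] x → WeightLattice x →
        Σ (Fin g) λ k → InZSpan A[ G ] (x ⊖ r k) × (∀ k′ → InZSpan A[ G ] (x ⊖ r k′) → k′ ≡ k)
      cosets x x∈span (_ , t , x-t∈ℤ) =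
        k , t-τk∈ℤ⇒x-rk∈ZSpan x∈span x-t∈ℤ k t-τk∈ℤ , λ k′ x-rk′∈ZSpan →
          τ-injective-modℤ k′ k
            (IsInt-resp (solve 3 (λ t a b → a :- b := (t :- b) :- (t :- a)) refl t (τ k′) (τ k))
                        (IsInt-minus t-τk∈ℤ (x-rk∈ZSpan⇒t-τk∈ℤ x∈span x-t∈ℤ i k′ x-rk′∈ZSpan)))
        where
        k : Fin g
        k = proj₁ (τ-surjective-modℤ t (t·g∈ℤ x∈span x-t∈ℤ))
        t-τk∈ℤ : IsInt (t - τ k)
        t-τk∈ℤ = proj₂ (τ-surjective-modℤ t (t·g∈ℤ x∈span x-t∈ℤ))

  weightMultiplicity : Fin v → HasIndex WeightLattice A[ G ] (compGcd L)
  weightMultiplicity i =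
    subst (HasIndex WeightLattice A[ G ]) (sym (proj₂ g)) (WeightCosets.hasIndex (proj₁ g) (proj₂ g) i)
    where g = compGcd≡suc i

lemma4p5 : (v : ℕ) → 1 ≤ v → (G : SimpleGraph v) → (c : ℕ) → (L : ComponentLabelling G c) →
    Multiplicity≡ RootLattice A[ G ] 1 × Multiplicity≡ WeightLattice A[ G ] (compGcd L)
lemma4p5 (suc v) _ G c L = rootMultiplicity , weightMultiplicity zero
  where open Components G L
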